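{- Let $p\ge 2$ and $n\ge 2$ be integers, let $E\in\mathbb{Z}[X]$ be a monic polynomial of degree $n$, and let $\gamma$ be an integer with $0<\gamma<p$ and $E(\gamma)\equiv 0\pmod p$. Let $\mathfrak{L}\subseteq\mathbb{Z}^n$ be the lattice generated by the rows $A_0=(p,0,\dots,0)$ and $A_i=-\gamma e_{i-1}+e_i$ for $1\le i\le n-1$. Let $\mathbf{B}=(b_{i,j})_{0\le i,j\le n-1}$ be an $n\times n$ matrix whose rows $B_0,\dots,B_{n-1}$ form a basis of $\mathfrak{L}$, and let $\|\mathbf{B}\|_1=\max_j\sum_{i=0}^{n-1}|b_{i,j}|$. If $\rho>\frac12\|\mathbf{B}\|_1$, then $(p,n,\gamma,\rho)_E$ is a Polynomial Modular Number System.
   Context: A Polynomial Modular Number System (PMNS) $(p,n,\gamma,\rho)_E$ consists of integers $p,n,\gamma,\rho$ and a monic polynomial $E\in\mathbb{Z}[X]$ of degree $n$ such that $0<\gamma<p$, $E(\gamma)\equiv 0 \pmod p$, and for every integer $x\in\{0,\dots,p-1\}$ there exist integers $x_0,\dots,x_{n-1}$ with $-\rho<x_i<\rho$ for all $i$ and $x\equiv \sum_{i=0}^{n-1}x_i\gamma^i \pmod p$. Here $e_0,\dots,e_{n-1}$ is the standard basis of $\mathbb{Z}^n$. -}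

module Defs where

open import Data.Nat as ℕ using (ℕ; zero; suc; _⊔_)
open import Data.Integer using (ℤ; +_; -_; _+_; _-_; _*_; _^_; _<_; ∣_∣)
open import Data.Integer.Divisibility using (_∣_)
open import Data.Fin using (Fin; zero; suc; toℕ; inject₁; _≟_)
open import Data.Product using (Σ; ∃; _×_; _,_)
open import Data.Bool using (if_then_else_)
open import Relation.Nullary using (does)
open import Relation.Binary.PropositionalEquality using (_≡_)

-- vectors of ℤ^n are functions Fin n → ℤ; n×n matrices are Fin n → Fin n → ℤ (row index first)
Vecℤ : ℕ → Set
Vecℤ n = Fin n → ℤ

Mat : ℕ → Set
Mat n = Fin n → Fin n → ℤ

sumℤ : ∀ {n} → (Fin n → ℤ) → ℤ
sumℤ {zero} f = + 0
sumℤ {suc n} f = f zero + sumℤ (λ i → f (suc i))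

sumℕ : ∀ {n} → (Fin n → ℕ) → ℕ
sumℕ {zero} f = 0
sumℕ {suc n} f = f zero ℕ.+ sumℕ (λ i → f (suc i))

maxℕ : ∀ {n} → (Fin n → ℕ) → ℕ
maxℕ {zero} f = 0
maxℕ {suc n} f = f zero ⊔ maxℕ (λ i → f (suc i))

_≡_[mod_] : ℤ → ℤ → ℤ → Set
a ≡ b [mod p ] = p ∣ (a - b)

-- A monic polynomial of degree n, E = X^n + Σ_{i<n} c i X^i, given by its lower coefficients c.
MonicPoly : ℕ → Set
MonicPoly n = Fin n → ℤ

evalMonic : ∀ {n} → MonicPoly n → ℤ → ℤ
evalMonic {n} c x = x ^ n + sumℤ (λ i → c i * x ^ toℕ i)

-- The generators A_0 = (p,0,…,0), A_i = -γ e_{i-1} + e_i (1 ≤ i ≤ n-1), as rows of a matrix.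
genA : ∀ {n} → ℤ → ℤ → Mat n
genA p γ zero zero = p
genA p γ zero (suc j) = + 0
genA p γ (suc i) j =
  if does (j ≟ inject₁ i) then - γ else (if does (j ≟ suc i) then + 1 else + 0)

InSpan : ∀ {n} → Mat n → Vecℤ n → Set
InSpan {n} G v = Σ (Fin n → ℤ) λ c → ∀ j → v j ≡ sumℤ (λ i → c i * G i j)

InLattice : ∀ {n} → ℤ → ℤ → Vecℤ n → Set
InLattice p γ v = InSpan (genA p γ) v

RowsIndependent : ∀ {n} → Mat n → Set
RowsIndependent {n} B =
  (c : Fin n → ℤ) → (∀ j → sumℤ (λ i → c i * B i j) ≡ + 0) → ∀ i → c i ≡ + 0

IsLatticeBasis : ∀ {n} → ℤ → ℤ → Mat n → Set
IsLatticeBasis p γ B =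
  (∀ i → InLattice p γ (B i))
  × (∀ v → InLattice p γ v → InSpan B v)
  × RowsIndependent B

norm₁ : ∀ {n} → Mat n → ℕ
norm₁ B = maxℕ (λ j → sumℕ (λ i → ∣ B i j ∣))

IsPMNS : (p : ℤ) (n : ℕ) (γ ρ : ℤ) (E : MonicPoly n) → Set
IsPMNS p n γ ρ E =
  (+ 0 < γ) × (γ < p) × (evalMonic E γ ≡ + 0 [mod p ])
  × (∀ (x : ℤ) → + 0 Data.Integer.≤ x → x < p →
       Σ (Fin n → ℤ) λ xs → (∀ i → (- ρ < xs i) × (xs i < ρ))
         × (x ≡ sumℤ (λ i → xs i * γ ^ toℕ i) [mod p ]))

-- Every x ∈ [0, p) gives the lattice vector p·x e₀ = Σ c_i B_i. Rounding each c_i to a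
-- nearest multiple k_i p yields v = x e₀ − Σ k_i B_i with p v = Σ (c_i − k_i p) B_i and
-- |c_i − k_i p| ≤ p/2, so every |v_j| ≤ ½ Σ_i |b_{i,j}| ≤ ½ ‖B‖₁ < ρ. Since the map
-- u ↦ Σ u_j γ^j sends each generator A_i, hence every lattice vector, to a multiple of p,
-- the vector v still represents x modulo p.
module Submission where

open import Defs
open import Data.Nat using (ℕ)
open import Data.Integer using (ℤ; +_; _*_; _<_; _≤_)
import Data.Nat as ℕ
import Data.Nat.Properties as ℕ
open import Data.Integer using (-[1+_]; _+_; _-_; -_; ∣_∣; _^_; _⊖_; +<+; -<+; -<-; +≤+)
import Data.Integer.Properties as ℤ
open import Data.Integer.DivMod using (_%ℕ_; _/ℕ_; n%ℕd<d; a≡a%ℕn+[a/ℕn]*n)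
open import Data.Integer.Divisibility.Signed
  using (divides; ∣-refl; ∣m∣n⇒∣m+n; ∣n⇒∣m*n; ∣⇒∣ᵤ)
  renaming (_∣_ to _∣ₛ_)
open import Data.Integer.Tactic.RingSolver using (solve-∀)
import Algebra.Properties.Semiring.Sum ℤ.+-*-semiring as ∑
open import Data.Fin using (Fin; zero; suc; toℕ; inject₁; _≟_)
open import Data.Fin.Properties using (toℕ-inject₁)
open import Data.Product using (Σ; ∃; _×_; _,_; proj₁; proj₂)
open import Data.Bool using (if_then_else_)
open import Relation.Nullary using (Dec; yes; no; does)
open import Relation.Binary.PropositionalEquality
open import Data.Empty using (⊥-elim)

private
  variable
    n : ℕ

sumℤ≡sum : (f : Fin n → ℤ) → sumℤ f ≡ ∑.sum f
sumℤ≡sum {ℕ.zero}  f = refl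
sumℤ≡sum {ℕ.suc n} f = cong (_+_ (f zero)) (sumℤ≡sum (λ i → f (suc i)))

sumℤ-cong : {f g : Fin n → ℤ} → (∀ i → f i ≡ g i) → sumℤ f ≡ sumℤ g
sumℤ-cong {f = f} {g} f≗g =
  trans (sumℤ≡sum f) (trans (∑.sum-cong-≗ f≗g) (sym (sumℤ≡sum g)))

sumℤ-zero : ∀ n → sumℤ {n} (λ _ → + 0) ≡ + 0
sumℤ-zero n = trans (sumℤ≡sum {n} (λ _ → + 0)) (∑.sum-replicate-zero n)

sumℤ-comm : ∀ {m} (f : Fin m → Fin n → ℤ) →
  sumℤ (λ i → sumℤ (λ j → f i j)) ≡ sumℤ (λ j → sumℤ (λ i → f i j))
sumℤ-comm {n} {m} f = begin
  sumℤ (λ i → sumℤ (f i))                 ≡⟨ sumℤ-cong {m} (λ i → sumℤ≡sum (f i)) ⟩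
  sumℤ (λ i → ∑.sum (f i))                ≡⟨ sumℤ≡sum (λ i → ∑.sum (f i)) ⟩
  ∑.sum (λ i → ∑.sum (f i))               ≡⟨ ∑.∑-comm f ⟩
  ∑.sum (λ j → ∑.sum (λ i → f i j))       ≡⟨ sumℤ≡sum (λ j → ∑.sum (λ i → f i j)) ⟨
  sumℤ (λ j → ∑.sum (λ i → f i j))        ≡⟨ sumℤ-cong {n} (λ j → sumℤ≡sum (λ i → f i j)) ⟨
  sumℤ (λ j → sumℤ (λ i → f i j))         ∎
  where open ≡-Reasoning

*-distribˡ-sumℤ : ∀ a (f : Fin n → ℤ) → a * sumℤ f ≡ sumℤ (λ i → a * f i)
*-distribˡ-sumℤ a f =
  trans (cong (a *_) (sumℤ≡sum f)) (trans (∑.*-distribˡ-sum a f) (sym (sumℤ≡sum (λ i → a * f i))))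

*-distribʳ-sumℤ : ∀ a (f : Fin n → ℤ) → sumℤ f * a ≡ sumℤ (λ i → f i * a)
*-distribʳ-sumℤ a f =
  trans (cong (_* a) (sumℤ≡sum f)) (trans (∑.*-distribʳ-sum a f) (sym (sumℤ≡sum (λ i → f i * a))))

sumℤ-distrib-+ : (f g : Fin n → ℤ) → sumℤ (λ i → f i + g i) ≡ sumℤ f + sumℤ g
sumℤ-distrib-+ f g = trans (sumℤ≡sum (λ i → f i + g i))
  (trans (∑.∑-distrib-+ f g) (sym (cong₂ _+_ (sumℤ≡sum f) (sumℤ≡sum g))))

sumℤ-distrib-- : (f g : Fin n → ℤ) → sumℤ (λ i → f i - g i) ≡ sumℤ f - sumℤ g
sumℤ-distrib-- {ℕ.zero}  f g = refl
sumℤ-distrib-- {ℕ.suc n} f g =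
  trans (cong (_+_ (f zero - g zero)) (sumℤ-distrib-- (λ i → f (suc i)) (λ i → g (suc i))))
        (interchange (f zero) (g zero) _ _)
  where
  interchange : ∀ a b s t → (a - b) + (s - t) ≡ (a + s) - (b + t)
  interchange = solve-∀

sumℤ-indicator : (k : Fin n) (f : Fin n → ℤ) →
  sumℤ (λ j → if does (j ≟ k) then f j else + 0) ≡ f k
sumℤ-indicator {ℕ.suc n} zero    f = trans (cong (_+_ (f zero)) (sumℤ-zero n)) (ℤ.+-identityʳ _)
sumℤ-indicator {ℕ.suc n} (suc k) f = trans (ℤ.+-identityˡ _) (sumℤ-indicator k (λ j → f (suc j)))

∣ₛ-sumℤ : ∀ {d} (f : Fin n → ℤ) → (∀ i → d ∣ₛ f i) → d ∣ₛ sumℤ f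
∣ₛ-sumℤ {ℕ.zero}  f d∣f = divides (+ 0) refl
∣ₛ-sumℤ {ℕ.suc n} f d∣f = ∣m∣n⇒∣m+n (d∣f zero) (∣ₛ-sumℤ (λ i → f (suc i)) (λ i → d∣f (suc i)))

combination : (Fin n → ℤ) → Mat n → Vecℤ n
combination c G j = sumℤ (λ i → c i * G i j)

eval : ℤ → Vecℤ n → ℤ
eval γ u = sumℤ (λ j → u j * γ ^ toℕ j)

eval-cong : ∀ γ {u v : Vecℤ n} → (∀ j → u j ≡ v j) → eval γ u ≡ eval γ v
eval-cong {n} γ u≗v = sumℤ-cong {n} (λ j → cong (_* _) (u≗v j))

eval-- : ∀ γ (u v : Vecℤ n) → eval γ (λ j → u j - v j) ≡ eval γ u - eval γ v
eval-- {n} γ u v = trans (sumℤ-cong {n} (λ j → *-distribʳ-- (u j) (v j) _))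
                     (sumℤ-distrib-- (λ j → u j * γ ^ toℕ j) (λ j → v j * γ ^ toℕ j))
  where
  *-distribʳ-- : ∀ a b g → (a - b) * g ≡ a * g - b * g
  *-distribʳ-- = solve-∀

eval-combination : ∀ γ (c : Fin n → ℤ) (G : Mat n) →
  eval γ (combination c G) ≡ sumℤ (λ i → c i * eval γ (G i))
eval-combination {n} γ c G = begin
  sumℤ (λ j → sumℤ (λ i → c i * G i j) * γ ^ toℕ j)    ≡⟨ sumℤ-cong {n} (λ j → *-distribʳ-sumℤ _ (λ i → c i * G i j)) ⟩
  sumℤ (λ j → sumℤ (λ i → c i * G i j * γ ^ toℕ j))    ≡⟨ sumℤ-comm (λ j i → c i * G i j * γ ^ toℕ j) ⟩
  sumℤ (λ i → sumℤ (λ j → c i * G i j * γ ^ toℕ j))    ≡⟨ sumℤ-cong {n} (λ i → sumℤ-cong {n} (λ j → ℤ.*-assoc (c i) _ _)) ⟩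
  sumℤ (λ i → sumℤ (λ j → c i * (G i j * γ ^ toℕ j)))  ≡⟨ sumℤ-cong {n} (λ i → *-distribˡ-sumℤ (c i) (λ j → G i j * γ ^ toℕ j)) ⟨
  sumℤ (λ i → c i * eval γ (G i))                      ∎
  where open ≡-Reasoning

∣ₛ-eval-span : ∀ {d} γ (G : Mat n) {v : Vecℤ n} →
  (∀ i → d ∣ₛ eval γ (G i)) → InSpan G v → d ∣ₛ eval γ v
∣ₛ-eval-span γ G d∣G (c , v≡cG) =
  subst (_ ∣ₛ_) (sym (trans (eval-cong γ v≡cG) (eval-combination γ c G)))
        (∣ₛ-sumℤ _ (λ i → ∣n⇒∣m*n (c i) (d∣G i)))

eval-supported-at-zero : ∀ γ (u : Vecℤ (ℕ.suc n)) → (∀ j → u (suc j) ≡ + 0) → eval γ u ≡ u zero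
eval-supported-at-zero {n} γ u u≡0 =
  trans (cong₂ _+_ (ℤ.*-identityʳ (u zero))
                   (trans (sumℤ-cong {n} (λ j → trans (cong (_* _) (u≡0 j)) (ℤ.*-zeroˡ (γ ^ toℕ (suc j))))) (sumℤ-zero n)))
        (ℤ.+-identityʳ (u zero))

eval-genA-suc : ∀ p γ (i : Fin n) → eval γ (genA p γ (suc i)) ≡ + 0
eval-genA-suc {n} p γ i = begin
  eval γ (genA p γ (suc i))                   ≡⟨ sumℤ-cong {ℕ.suc n} split ⟩
  sumℤ (λ j → at-i j + at-1+i j)              ≡⟨ sumℤ-distrib-+ at-i at-1+i ⟩
  sumℤ at-i + sumℤ at-1+i                     ≡⟨ cong₂ _+_ (sumℤ-indicator (inject₁ i) (λ j → - γ * γ ^ toℕ j)) (sumℤ-indicator (suc i) (λ j → γ ^ toℕ j)) ⟩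
  - γ * γ ^ toℕ (inject₁ i) + γ * γ ^ toℕ i   ≡⟨ cong (λ e → - γ * γ ^ e + γ * γ ^ toℕ i) (toℕ-inject₁ i) ⟩
  - γ * γ ^ toℕ i + γ * γ ^ toℕ i             ≡⟨ cancel γ (γ ^ toℕ i) ⟩
  + 0                                         ∎
  where
  open ≡-Reasoning
  at-i at-1+i : Fin (ℕ.suc n) → ℤ
  at-i   j = if does (j ≟ inject₁ i) then - γ * γ ^ toℕ j else + 0
  at-1+i j = if does (j ≟ suc i) then γ ^ toℕ j else + 0
  cancel : ∀ g h → - g * h + g * h ≡ + 0
  cancel = solve-∀
  split : ∀ j → genA p γ (suc i) j * γ ^ toℕ j ≡ at-i j + at-1+i j
  split j with j ≟ inject₁ i | j ≟ suc i
  ... | yes refl | yes i≡1+i = ⊥-elim (ℕ.1+n≢n (sym (trans (sym (toℕ-inject₁ i)) (cong toℕ i≡1+i))))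
  ... | yes _    | no _      = sym (ℤ.+-identityʳ _)
  ... | no _     | yes _     = trans (ℤ.*-identityˡ _) (sym (ℤ.+-identityˡ _))
  ... | no _     | no _      = ℤ.*-zeroˡ (γ ^ toℕ j)

p∣eval-lattice : ∀ p γ {v : Vecℤ (ℕ.suc n)} → InLattice p γ v → p ∣ₛ eval γ v
p∣eval-lattice {n} p γ = ∣ₛ-eval-span γ (genA p γ) p∣generator
  where
  p∣generator : ∀ i → p ∣ₛ eval γ (genA p γ i)
  p∣generator zero    = subst (p ∣ₛ_) (sym (eval-supported-at-zero γ (genA {ℕ.suc n} p γ zero) (λ _ → refl))) ∣-refl
  p∣generator (suc i) = divides (+ 0) (eval-genA-suc p γ i)

_·e₀ : ℤ → Vecℤ (ℕ.suc n)
(x ·e₀) zero    = x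
(x ·e₀) (suc _) = + 0

p·e₀∈lattice : ∀ p γ x → InLattice {ℕ.suc n} p γ (λ j → p * (x ·e₀) j)
p·e₀∈lattice {n} p γ x = x ·e₀ , column
  where
  others : ∀ j → sumℤ {n} (λ i → + 0 * genA p γ (suc i) j) ≡ + 0
  others j = trans (sumℤ-cong {n} (λ i → ℤ.*-zeroˡ (genA p γ (suc i) j))) (sumℤ-zero n)
  column : ∀ j → p * (x ·e₀) j ≡ combination (x ·e₀) (genA p γ) j
  column zero    = sym (trans (cong₂ _+_ (ℤ.*-comm x p) (others zero)) (ℤ.+-identityʳ _))
  column (suc j) = trans (ℤ.*-zeroʳ p)
                         (sym (trans (cong₂ _+_ (ℤ.*-zeroʳ x) (others (suc j))) (ℤ.+-identityʳ _)))

twice-excess≤ : ∀ {r P} → P ℕ.< 2 ℕ.* r → 2 ℕ.* (P ℕ.∸ r) ℕ.≤ P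
twice-excess≤ {r} {P} P<2r = subst (ℕ._≤ P) (sym (ℕ.*-distribˡ-∸ 2 P r))
  (ℕ.m≤n+o⇒m∸n≤o (2 ℕ.* P) (2 ℕ.* r)
    (subst (ℕ._≤ 2 ℕ.* r ℕ.+ P) (cong (P ℕ.+_) (sym (ℕ.+-identityʳ P)))
           (ℕ.+-monoˡ-≤ P (ℕ.<⇒≤ P<2r))))

nearest-multiple : (c : ℤ) (P : ℕ) .{{_ : ℕ.NonZero P}} →
  ∃ λ k → 2 ℕ.* ∣ c - k * + P ∣ ℕ.≤ P
nearest-multiple c P = round (2 ℕ.* r ℕ.≤? P)
  where
  r = c %ℕ P
  q = c /ℕ P
  c-qP≡r : c - q * + P ≡ + r
  c-qP≡r = trans (cong (λ t → t - q * + P) (a≡a%ℕn+[a/ℕn]*n c P)) (cancel (+ r) q (+ P))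
    where
    cancel : ∀ a b d → (a + b * d) - b * d ≡ a
    cancel = solve-∀
  c-[q+1]P≡r⊖P : c - (q + + 1) * + P ≡ r ⊖ P
  c-[q+1]P≡r⊖P = trans (cong (λ t → t - (q + + 1) * + P) (a≡a%ℕn+[a/ℕn]*n c P))
                       (trans (overshoot (+ r) q (+ P)) (ℤ.m-n≡m⊖n r P))
    where
    overshoot : ∀ a b d → (a + b * d) - (b + + 1) * d ≡ a - d
    overshoot = solve-∀
  round : Dec (2 ℕ.* r ℕ.≤ P) → ∃ λ k → 2 ℕ.* ∣ c - k * + P ∣ ℕ.≤ P
  round (yes 2r≤P) = q , subst (λ t → 2 ℕ.* ∣ t ∣ ℕ.≤ P) (sym c-qP≡r) 2r≤P
  round (no 2r≰P)  = q + + 1 ,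
    subst (λ t → 2 ℕ.* t ℕ.≤ P)
          (sym (trans (cong ∣_∣ c-[q+1]P≡r⊖P) (ℤ.∣⊖∣-< (n%ℕd<d c P))))
          (twice-excess≤ {r} (ℕ.≰⇒> 2r≰P))

twice-abs-weighted-sum≤ : ∀ P (e b : Fin n → ℤ) → (∀ i → 2 ℕ.* ∣ e i ∣ ℕ.≤ P) →
  2 ℕ.* ∣ sumℤ (λ i → e i * b i) ∣ ℕ.≤ P ℕ.* sumℕ (λ i → ∣ b i ∣)
twice-abs-weighted-sum≤ {ℕ.zero}  P e b small = ℕ.z≤n
twice-abs-weighted-sum≤ {ℕ.suc n} P e b small = begin
  2 ℕ.* ∣ e₀b₀ + S ∣                                   ≤⟨ ℕ.*-monoʳ-≤ 2 (ℤ.∣i+j∣≤∣i∣+∣j∣ e₀b₀ S) ⟩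
  2 ℕ.* (∣ e₀b₀ ∣ ℕ.+ ∣ S ∣)                           ≡⟨ ℕ.*-distribˡ-+ 2 ∣ e₀b₀ ∣ ∣ S ∣ ⟩
  2 ℕ.* ∣ e₀b₀ ∣ ℕ.+ 2 ℕ.* ∣ S ∣                       ≡⟨ cong (λ t → 2 ℕ.* t ℕ.+ 2 ℕ.* ∣ S ∣) (ℤ.abs-* (e zero) (b zero)) ⟩
  2 ℕ.* (∣ e zero ∣ ℕ.* ∣ b zero ∣) ℕ.+ 2 ℕ.* ∣ S ∣    ≡⟨ cong (ℕ._+ 2 ℕ.* ∣ S ∣) (ℕ.*-assoc 2 ∣ e zero ∣ ∣ b zero ∣) ⟨
  2 ℕ.* ∣ e zero ∣ ℕ.* ∣ b zero ∣ ℕ.+ 2 ℕ.* ∣ S ∣      ≤⟨ ℕ.+-mono-≤ (ℕ.*-monoˡ-≤ ∣ b zero ∣ (small zero))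
                                                           (twice-abs-weighted-sum≤ P (λ i → e (suc i)) (λ i → b (suc i)) (λ i → small (suc i))) ⟩
  P ℕ.* ∣ b zero ∣ ℕ.+ P ℕ.* sumℕ (λ i → ∣ b (suc i) ∣) ≡⟨ ℕ.*-distribˡ-+ P ∣ b zero ∣ _ ⟨
  P ℕ.* sumℕ (λ i → ∣ b i ∣)                           ∎
  where
  open ℕ.≤-Reasoning
  e₀b₀ = e zero * b zero
  S = sumℤ (λ i → e (suc i) * b (suc i))

twice-abs≤-of-scaled : ∀ P .{{_ : ℕ.NonZero P}} (e b : Fin n → ℤ) (ε : ℤ) →
  (∀ i → 2 ℕ.* ∣ e i ∣ ℕ.≤ P) → + P * ε ≡ sumℤ (λ i → e i * b i) →
  2 ℕ.* ∣ ε ∣ ℕ.≤ sumℕ (λ i → ∣ b i ∣)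
twice-abs≤-of-scaled P e b ε small Pε≡ = ℕ.*-cancelˡ-≤ P (begin
  P ℕ.* (2 ℕ.* ∣ ε ∣)       ≡⟨ ℕ.*-assoc P 2 ∣ ε ∣ ⟨
  P ℕ.* 2 ℕ.* ∣ ε ∣         ≡⟨ cong (ℕ._* ∣ ε ∣) (ℕ.*-comm P 2) ⟩
  2 ℕ.* P ℕ.* ∣ ε ∣         ≡⟨ ℕ.*-assoc 2 P ∣ ε ∣ ⟩
  2 ℕ.* (P ℕ.* ∣ ε ∣)       ≡⟨ cong (2 ℕ.*_) (ℤ.abs-* (+ P) ε) ⟨
  2 ℕ.* ∣ + P * ε ∣         ≡⟨ cong (λ t → 2 ℕ.* ∣ t ∣) Pε≡ ⟩
  2 ℕ.* ∣ sumℤ (λ i → e i * b i) ∣ ≤⟨ twice-abs-weighted-sum≤ P e b small ⟩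
  P ℕ.* sumℕ (λ i → ∣ b i ∣) ∎)
  where open ℕ.≤-Reasoning

≤-maxℕ : (f : Fin n → ℕ) (j : Fin n) → f j ℕ.≤ maxℕ f
≤-maxℕ f zero    = ℕ.m≤m⊔n (f zero) _
≤-maxℕ f (suc j) = ℕ.≤-trans (≤-maxℕ (λ i → f (suc i)) j) (ℕ.m≤n⊔m (f zero) _)

column-sum≤norm₁ : (B : Mat n) (j : Fin n) → sumℕ (λ i → ∣ B i j ∣) ℕ.≤ norm₁ B
column-sum≤norm₁ B = ≤-maxℕ (λ j → sumℕ (λ i → ∣ B i j ∣))

rounding-error≤ : ∀ P .{{_ : ℕ.NonZero P}} (B : Mat n) (v : Vecℤ n) (c k : Fin n → ℤ) →
  (∀ j → + P * v j ≡ combination c B j) → (∀ i → 2 ℕ.* ∣ c i - k i * + P ∣ ℕ.≤ P) →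
  ∀ j → 2 ℕ.* ∣ v j - combination k B j ∣ ℕ.≤ sumℕ (λ i → ∣ B i j ∣)
rounding-error≤ {n} P B v c k Pv≡cB near j =
  twice-abs≤-of-scaled P (λ i → c i - k i * + P) (λ i → B i j) _ near (begin
    + P * (v j - combination k B j)                           ≡⟨ *-distribˡ-- (+ P) (v j) _ ⟩
    + P * v j - + P * combination k B j                       ≡⟨ cong₂ _-_ (Pv≡cB j) (*-distribˡ-sumℤ (+ P) (λ i → k i * B i j)) ⟩
    combination c B j - sumℤ (λ i → + P * (k i * B i j))      ≡⟨ sumℤ-distrib-- (λ i → c i * B i j) (λ i → + P * (k i * B i j)) ⟨
    sumℤ (λ i → c i * B i j - + P * (k i * B i j))            ≡⟨ sumℤ-cong {n} (λ i → regroup (c i) (k i) (B i j) (+ P)) ⟩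
    sumℤ (λ i → (c i - k i * + P) * B i j)                    ∎)
  where
  open ≡-Reasoning
  *-distribˡ-- : ∀ d a b → d * (a - b) ≡ d * a - d * b
  *-distribˡ-- = solve-∀
  regroup : ∀ a κ b d → a * b - d * (κ * b) ≡ (a - κ * d) * b
  regroup = solve-∀

within-half : ∀ (ε ρ : ℤ) N → 2 ℕ.* ∣ ε ∣ ℕ.≤ N → + N < + 2 * ρ → (- ρ < ε) × (ε < ρ)
within-half ε        (+ ℕ.zero)  N small (+<+ ())
within-half ε        -[1+ r ]    N small ()
within-half (+ e)    (+ ℕ.suc r) N small N<2ρ =
  -<+ , +<+ (ℕ.*-cancelˡ-< 2 e (ℕ.suc r) (ℕ.≤-<-trans small (ℤ.drop‿+<+ N<2ρ)))
within-half -[1+ e ] (+ ℕ.suc r) N small N<2ρ =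
  -<- (ℕ.≤-pred (ℕ.*-cancelˡ-< 2 (ℕ.suc e) (ℕ.suc r) (ℕ.≤-<-trans small (ℤ.drop‿+<+ N<2ρ)))) , -<+

small-representative : ∀ P .{{_ : ℕ.NonZero P}} γ (B : Mat (ℕ.suc n)) →
  (∀ i → InLattice (+ P) γ (B i)) → (∀ v → InLattice (+ P) γ v → InSpan B v) → ∀ x →
  Σ (Vecℤ (ℕ.suc n)) λ xs → (∀ j → 2 ℕ.* ∣ xs j ∣ ℕ.≤ norm₁ B) × (+ P ∣ₛ x - eval γ xs)
small-representative {n} P γ B B∈𝔏 𝔏⊆spanB x = xs , small , subst (_ ∣ₛ_) eval-w≡ p∣eval-w
  where
  x₀ : Vecℤ (ℕ.suc n)
  x₀ = x ·e₀
  spanned = 𝔏⊆spanB _ (p·e₀∈lattice (+ P) γ x)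
  c = proj₁ spanned
  k = λ i → proj₁ (nearest-multiple (c i) P)
  w = combination k B
  xs = λ j → x₀ j - w j
  small : ∀ j → 2 ℕ.* ∣ xs j ∣ ℕ.≤ norm₁ B
  small j = ℕ.≤-trans
    (rounding-error≤ P B x₀ c k (proj₂ spanned) (λ i → proj₂ (nearest-multiple (c i) P)) j)
    (column-sum≤norm₁ B j)
  p∣eval-w : + P ∣ₛ eval γ w
  p∣eval-w = ∣ₛ-eval-span γ B (λ i → p∣eval-lattice (+ P) γ (B∈𝔏 i)) (k , λ _ → refl)
  a-[a-b]≡b : ∀ a b → a - (a - b) ≡ b
  a-[a-b]≡b = solve-∀
  eval-w≡ : eval γ w ≡ x - eval γ xs
  eval-w≡ = sym (begin
    x - eval γ xs              ≡⟨ cong (_-_ x) (eval-- γ x₀ w) ⟩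
    x - (eval γ x₀ - eval γ w) ≡⟨ cong (λ t → x - (t - eval γ w)) (eval-supported-at-zero γ x₀ (λ _ → refl)) ⟩
    x - (x - eval γ w)         ≡⟨ a-[a-b]≡b x (eval γ w) ⟩
    eval γ w                   ∎)
    where open ≡-Reasoning

theorem2 : (p : ℤ) (n : ℕ) (E : MonicPoly n) (γ ρ : ℤ) (B : Mat n)
    → + 2 ≤ p → 2 Data.Nat.≤ n
    → + 0 < γ → γ < p → evalMonic E γ ≡ + 0 [mod p ]
    → IsLatticeBasis p γ B
    → + (norm₁ B) < + 2 * ρ
    → IsPMNS p n γ ρ E
theorem2 (+ P@(ℕ.suc _)) (ℕ.suc m) E γ ρ B (+≤+ (ℕ.s≤s _)) (ℕ.s≤s _) 0<γ γ<p E[γ]≡0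
         (B∈𝔏 , 𝔏⊆spanB , _) ‖B‖<2ρ =
  0<γ , γ<p , E[γ]≡0 , λ x _ _ → representation x
  where
  representation : ∀ x → Σ (Fin (ℕ.suc m) → ℤ) λ xs → (∀ i → (- ρ < xs i) × (xs i < ρ))
                                                   × (x ≡ sumℤ (λ i → xs i * γ ^ toℕ i) [mod + P ])
  representation x =
    let xs , small , p∣x-xs = small-representative P γ B B∈𝔏 𝔏⊆spanB x
    in xs , (λ j → within-half (xs j) ρ (norm₁ B) (small j) ‖B‖<2ρ) , ∣⇒∣ᵤ p∣x-xs
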